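{- If $G$ is a disconnected graph on $n \geq 2$ vertices, then $G$ has the de Bruijn–Erdős property, i.e., $G$ has a universal line or at least $n$ distinct lines.
   Context: A graph $G$ is viewed as the metric space $(V(G),\mathrm{dist})$ where $\mathrm{dist}$ is the shortest-path distance, with $\mathrm{dist}(u,v)=\infty$ when $u,v$ lie in different components (so a vertex $b$ is between $a$ and $c$ only if $\mathrm{dist}(a,b)+\mathrm{dist}(b,c)=\mathrm{dist}(a,c)$ with all terms finite). A vertex $b$ is between $a$ and $c$ if $\mathrm{dist}(a,b)+\mathrm{dist}(b,c)=\mathrm{dist}(a,c)$. Three vertices are collinear if they are pairwise distinct and one of them is between the other two. For distinct vertices $a,b$, the line $\overline{ab}$ is $\{a,b\}$ together with all vertices $c$ such that $a,b,c$ are collinear. A line is universal if it equals $V(G)$. A graph on $n$ vertices has the de Bruijn–Erdős property if it has a universal line or at least $n$ distinct lines. -}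

module Defs where

open import Data.Nat using (ℕ; zero; suc; _+_; _<_)
open import Data.Fin using (Fin)
open import Data.Bool using (Bool; true; false)
open import Data.Product using (Σ; ∃; _×_; _,_)
open import Data.Sum using (_⊎_)
open import Relation.Nullary using (¬_)
open import Relation.Binary.PropositionalEquality using (_≡_; _≢_)

record Graph (n : ℕ) : Set where
  field
    adj   : Fin n → Fin n → Bool
    sym   : ∀ u v → adj u v ≡ adj v u
    irrefl : ∀ u → adj u u ≡ false
open Graph public

module _ {n : ℕ} (G : Graph n) where

  data Walk : Fin n → Fin n → ℕ → Set where
    here : ∀ {u} → Walk u u zero
    step : ∀ {u w v k} → adj G u w ≡ true → Walk w v k → Walk u v (suc k)

  Dist : Fin n → Fin n → ℕ → Set
  Dist u v k = Walk u v k × (∀ m → m < k → ¬ Walk u v m)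

  Connected : Set
  Connected = ∀ u v → ∃ λ k → Walk u v k

  Disconnected : Set
  Disconnected = ¬ Connected

  Between : Fin n → Fin n → Fin n → Set
  Between a b c = Σ ℕ λ i → Σ ℕ λ j → Dist a b i × Dist b c j × Dist a c (i + j)

  Collinear : Fin n → Fin n → Fin n → Set
  Collinear a b c = (a ≢ b × b ≢ c × a ≢ c)
                  × (Between b a c ⊎ Between a b c ⊎ Between a c b)

  OnLine : Fin n → Fin n → Fin n → Set
  OnLine a b c = c ≡ a ⊎ c ≡ b ⊎ Collinear a b c

  HasUniversalLine : Set
  HasUniversalLine = Σ (Fin n) λ a → Σ (Fin n) λ b → a ≢ b × (∀ c → OnLine a b c)

  HasAtLeastNLines : Set
  HasAtLeastNLines =
    Σ (Fin n → Fin n) λ p → Σ (Fin n → Fin n) λ q →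
      (∀ i → p i ≢ q i) ×
      (∀ i j → i ≢ j → ¬ (∀ c → (OnLine (p i) (q i) c → OnLine (p j) (q j) c)
                                × (OnLine (p j) (q j) c → OnLine (p i) (q i) c)))

  DeBruijnErdos : Set
  DeBruijnErdos = HasUniversalLine ⊎ HasAtLeastNLines

-- Two vertices in different components span a line consisting of just these two
-- vertices, and such lines are distinct for distinct pairs. Fix v and u in different
-- components and let C be the component of v. If C contains a further vertex m, the
-- n lines are {x, u} for x ∈ C, {v, x} for x ∉ C with x ≠ u, and the line vm, which
-- lies inside C. If v is isolated, take the lines {x, v} for x ≠ v together with any
-- line through two vertices other than v; for n = 2 the only line is universal.
-- Reachability is decidable since, by the pigeonhole principle, every walk can be
-- shortened to length less than n.
module Submission where

open import Defs hiding (sym)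
open import Data.Nat using (ℕ; suc; _+_; _∸_; _<_; _≤_; _≥_; _<?_; s≤s)
open import Data.Nat.Properties using (≮⇒≥; +-monoˡ-<; m+[n∸m]≡n; module ≤-Reasoning)
open import Data.Nat.Induction using (<-wellFounded)
open import Data.Fin using (Fin; zero; suc; toℕ; fromℕ<)
open import Data.Fin.Properties
  using (_≟_; any?; all?; ¬∀⟶∃¬; pigeonhole; toℕ-fromℕ<; toℕ≤pred[n]; punchInᵢ≢i; punchIn-injective)
open import Data.Bool using (true)
import Data.Bool.Properties as Bool
open import Data.Product using (∃; ∃₂; _×_; _,_; proj₁; proj₂)
open import Data.Sum using (_⊎_; inj₁; inj₂)
open import Function using (_∘_)
open import Induction.WellFounded using (Acc; acc)
open import Relation.Nullary using (¬_; Dec; yes; no; contradiction)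
open import Relation.Nullary.Decidable using (_×-dec_; ¬?; decidable-stable)
open import Relation.Binary.PropositionalEquality
  using (_≡_; _≢_; refl; sym; trans; subst)

module _ {n : ℕ} (G : Graph n) where

  Reachable : Fin n → Fin n → Set
  Reachable a b = ∃ (Walk G a b)

  _▷_ : ∀ {a b c k} → Walk G a b k → adj G b c ≡ true → Walk G a c (suc k)
  here     ▷ e = step e here
  step f w ▷ e = step f (w ▷ e)

  reverse : ∀ {a b k} → Walk G a b k → Walk G b a k
  reverse here               = here
  reverse (step {a} {c} e w) = reverse w ▷ trans (Graph.sym G c a) e

  _++_ : ∀ {a b c k l} → Walk G a b k → Walk G b c l → Walk G a c (k + l)
  here     ++ w′ = w′
  step e w ++ w′ = step e (w ++ w′)

  reachable-refl : ∀ {a} → Reachable a a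
  reachable-refl = 0 , here

  reachable-sym : ∀ {a b} → Reachable a b → Reachable b a
  reachable-sym (k , w) = k , reverse w

  reachable-trans : ∀ {a b c} → Reachable a b → Reachable b c → Reachable a c
  reachable-trans (k , w) (l , w′) = k + l , w ++ w′

  unreachable⇒≢ : ∀ {a b} → ¬ Reachable a b → a ≢ b
  unreachable⇒≢ a↛b refl = a↛b reachable-refl

  reachable⇒≢unreachable : ∀ {a b c} → Reachable a b → ¬ Reachable a c → b ≢ c
  reachable⇒≢unreachable a⇝b a↛c refl = a↛c a⇝b

  vertexAt : ∀ {a b k} → Walk G a b k → Fin (suc k) → Fin n
  vertexAt {a} w          zero    = a
  vertexAt     (step _ w) (suc i) = vertexAt w i

  take : ∀ {a b k} (w : Walk G a b k) (i : Fin (suc k)) → Walk G a (vertexAt w i) (toℕ i)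
  take w          zero    = here
  take (step e w) (suc i) = step e (take w i)

  drop : ∀ {a b k} (w : Walk G a b k) (i : Fin (suc k)) → Walk G (vertexAt w i) b (k ∸ toℕ i)
  drop w          zero    = w
  drop (step e w) (suc i) = drop w i

  shortcut : ∀ {a b k} → n ≤ k → Walk G a b k → ∃ λ k′ → k′ < k × Walk G a b k′
  shortcut {a} {b} {k} n≤k w with pigeonhole (s≤s n≤k) (vertexAt w)
  ... | i , j , i<j , same = toℕ i + (k ∸ toℕ j) , shorter , take w i ++ drop′
    where
    open ≤-Reasoning
    shorter : toℕ i + (k ∸ toℕ j) < k
    shorter = begin-strict
      toℕ i + (k ∸ toℕ j) <⟨ +-monoˡ-< (k ∸ toℕ j) i<j ⟩
      toℕ j + (k ∸ toℕ j) ≡⟨ m+[n∸m]≡n (toℕ≤pred[n] j) ⟩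
      k                   ∎
    drop′ : Walk G (vertexAt w i) b (k ∸ toℕ j)
    drop′ = subst (λ x → Walk G x b (k ∸ toℕ j)) (sym same) (drop w j)

  shorten : ∀ {a b k} → Acc _<_ k → Walk G a b k → ∃ λ (i : Fin n) → Walk G a b (toℕ i)
  shorten {a} {b} {k} (acc rec) w with k <? n
  ... | yes k<n = fromℕ< k<n , subst (Walk G a b) (sym (toℕ-fromℕ< k<n)) w
  ... | no k≮n with shortcut (≮⇒≥ k≮n) w
  ...   | _ , k′<k , w′ = shorten (rec k′<k) w′

  walk? : ∀ k a b → Dec (Walk G a b k)
  walk? 0 a b with a ≟ b
  ... | yes refl = yes here
  ... | no a≢b   = no λ { here → a≢b refl }
  walk? (suc k) a b with any? (λ c → (adj G a c Bool.≟ true) ×-dec walk? k c b)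
  ... | yes (_ , e , w) = yes (step e w)
  ... | no ∄c           = no λ { (step e w) → ∄c (_ , e , w) }

  reachable? : ∀ a b → Dec (Reachable a b)
  reachable? a b with any? (λ (i : Fin n) → walk? (toℕ i) a b)
  ... | yes (i , w) = yes (toℕ i , w)
  ... | no ∄w       = no λ { (k , w) → ∄w (shorten (<-wellFounded k) w) }

  disconnected⇒unreachable : Disconnected G → ∃₂ λ v u → ¬ Reachable v u
  disconnected⇒unreachable disc with ¬∀⟶∃¬ n _ (λ v → all? (reachable? v)) disc
  ... | v , ¬∀u with ¬∀⟶∃¬ n _ (reachable? v) ¬∀u
  ...   | u , v↛u = v , u , v↛u

  Isolated : Fin n → Set
  Isolated v = ∀ x → Reachable v x → x ≡ v

  mate⊎isolated : ∀ v → (∃ λ m → m ≢ v × Reachable v m) ⊎ Isolated v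
  mate⊎isolated v with any? (λ m → ¬? (m ≟ v) ×-dec reachable? v m)
  ... | yes mate = inj₁ mate
  ... | no ∄mate = inj₂ λ x v⇝x → decidable-stable (x ≟ v) λ x≢v → ∄mate (x , x≢v , v⇝x)

  collinear⇒reachable : ∀ {a b c} → Collinear G a b c → Reachable a b × Reachable a c
  collinear⇒reachable (_ , inj₁ (i , j , (ba , _) , (ac , _) , _))        = (i , reverse ba) , (j , ac)
  collinear⇒reachable (_ , inj₂ (inj₁ (i , j , (ab , _) , _ , (ac , _)))) = (i , ab) , (i + j , ac)
  collinear⇒reachable (_ , inj₂ (inj₂ (i , j , (ac , _) , _ , (ab , _)))) = (i + j , ab) , (i , ac)

  line⊆component : ∀ {a b c} → Reachable a b → OnLine G a b c → Reachable a c
  line⊆component a⇝b (inj₁ refl)        = reachable-refl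
  line⊆component a⇝b (inj₂ (inj₁ refl)) = a⇝b
  line⊆component a⇝b (inj₂ (inj₂ col))  = proj₂ (collinear⇒reachable col)

  ∉crossLine : ∀ {a b c} → ¬ Reachable a b → c ≢ a → c ≢ b → ¬ OnLine G a b c
  ∉crossLine a↛b c≢a c≢b (inj₁ c≡a)        = c≢a c≡a
  ∉crossLine a↛b c≢a c≢b (inj₂ (inj₁ c≡b)) = c≢b c≡b
  ∉crossLine a↛b c≢a c≢b (inj₂ (inj₂ col)) = a↛b (proj₁ (collinear⇒reachable col))

  isolated∉line : ∀ {v a b} → Isolated v → a ≢ v → b ≢ v → ¬ OnLine G a b v
  isolated∉line iso a≢v b≢v (inj₁ v≡a)        = a≢v (sym v≡a)
  isolated∉line iso a≢v b≢v (inj₂ (inj₁ v≡b)) = b≢v (sym v≡b)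
  isolated∉line iso a≢v b≢v (inj₂ (inj₂ col)) =
    a≢v (iso _ (reachable-sym (proj₂ (collinear⇒reachable col))))

  SameLine : Fin n → Fin n → Fin n → Fin n → Set
  SameLine a b a′ b′ = ∀ c → (OnLine G a b c → OnLine G a′ b′ c) × (OnLine G a′ b′ c → OnLine G a b c)

  separatedˡ : ∀ {a b a′ b′ c} → OnLine G a b c → ¬ OnLine G a′ b′ c → ¬ SameLine a b a′ b′
  separatedˡ c∈ c∉ same = c∉ (proj₁ (same _) c∈)

  separatedʳ : ∀ {a b a′ b′ c} → ¬ OnLine G a b c → OnLine G a′ b′ c → ¬ SameLine a b a′ b′
  separatedʳ c∉ c∈ same = c∉ (proj₂ (same _) c∈)

  ˡ∈line : ∀ {a b} → OnLine G a b a
  ˡ∈line = inj₁ refl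

  ʳ∈line : ∀ {a b} → OnLine G a b b
  ʳ∈line = inj₂ (inj₁ refl)

  module NontrivialComponent {v m u : Fin n} (v⇝m : Reachable v m) (m≢v : m ≢ v) (v↛u : ¬ Reachable v u) where

    data Role (x : Fin n) : Set where
      inside  : Reachable v x → Role x
      atU     : x ≡ u → Role x
      outside : ¬ Reachable v x → x ≢ u → Role x

    role : ∀ x → Role x
    role x with reachable? v x | x ≟ u
    ... | yes v⇝x | _       = inside v⇝x
    ... | no v↛x  | yes x≡u = atU x≡u
    ... | no v↛x  | no x≢u  = outside v↛x x≢u

    p q : ∀ {x} → Role x → Fin n
    p {x} (inside _)    = x
    p     (atU _)       = v
    p     (outside _ _) = v
    q     (inside _)    = u
    q     (atU _)       = m
    q {x} (outside _ _) = x

    p≢q : ∀ {x} (r : Role x) → p r ≢ q r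
    p≢q (inside v⇝x)    = reachable⇒≢unreachable v⇝x v↛u
    p≢q (atU _)         = m≢v ∘ sym
    p≢q (outside v↛x _) = unreachable⇒≢ v↛x

    unreachable∉vm : ∀ {x} → ¬ Reachable v x → ¬ OnLine G v m x
    unreachable∉vm v↛x = v↛x ∘ line⊆component v⇝m

    u≢v : u ≢ v
    u≢v = unreachable⇒≢ v↛u ∘ sym

    distinct : ∀ {x y} → x ≢ y → (r : Role x) (s : Role y) → ¬ SameLine (p r) (q r) (p s) (q s)
    distinct x≢y (inside v⇝x) (inside v⇝y) =
      separatedˡ ˡ∈line (∉crossLine (v↛u ∘ reachable-trans v⇝y) x≢y (reachable⇒≢unreachable v⇝x v↛u))
    distinct x≢y (inside _) (atU _) = separatedˡ ʳ∈line (unreachable∉vm v↛u)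
    distinct x≢y (inside _) (outside v↛y y≢u) = separatedˡ ʳ∈line (∉crossLine v↛y u≢v (y≢u ∘ sym))
    distinct x≢y (atU _) (inside _) = separatedʳ (unreachable∉vm v↛u) ʳ∈line
    distinct x≢y (atU x≡u) (atU y≡u) = contradiction (trans x≡u (sym y≡u)) x≢y
    distinct x≢y (atU _) (outside v↛y _) = separatedʳ (unreachable∉vm v↛y) ʳ∈line
    distinct x≢y (outside v↛x x≢u) (inside _) = separatedʳ (∉crossLine v↛x u≢v (x≢u ∘ sym)) ʳ∈line
    distinct x≢y (outside v↛x _) (atU _) = separatedˡ ʳ∈line (unreachable∉vm v↛x)
    distinct x≢y (outside v↛x _) (outside v↛y _) =
      separatedˡ ʳ∈line (∉crossLine v↛y (unreachable⇒≢ v↛x ∘ sym) x≢y)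

    atLeastNLines : HasAtLeastNLines G
    atLeastNLines = (λ x → p (role x)) , (λ x → q (role x)) , (λ x → p≢q (role x)) ,
                    λ x y x≢y → distinct x≢y (role x) (role y)

  module IsolatedVertex {v a b : Fin n} (iso : Isolated v) (a≢v : a ≢ v) (b≢v : b ≢ v) (a≢b : a ≢ b) where

    data Role (x : Fin n) : Set where
      atV   : x ≡ v → Role x
      other : x ≢ v → Role x

    role : ∀ x → Role x
    role x with x ≟ v
    ... | yes x≡v = atV x≡v
    ... | no x≢v  = other x≢v

    p q : ∀ {x} → Role x → Fin n
    p     (atV _)   = a
    p {x} (other _) = x
    q     (atV _)   = b
    q     (other _) = v

    p≢q : ∀ {x} (r : Role x) → p r ≢ q r
    p≢q (atV _)     = a≢b
    p≢q (other x≢v) = x≢v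

    v∉ab : ¬ OnLine G a b v
    v∉ab = isolated∉line iso a≢v b≢v

    distinct : ∀ {x y} → x ≢ y → (r : Role x) (s : Role y) → ¬ SameLine (p r) (q r) (p s) (q s)
    distinct x≢y (atV x≡v)   (atV y≡v)   = contradiction (trans x≡v (sym y≡v)) x≢y
    distinct x≢y (atV _)     (other _)   = separatedʳ v∉ab ʳ∈line
    distinct x≢y (other _)   (atV _)     = separatedˡ ʳ∈line v∉ab
    distinct x≢y (other x≢v) (other y≢v) =
      separatedˡ ˡ∈line (∉crossLine (λ y⇝v → y≢v (iso _ (reachable-sym y⇝v))) x≢y x≢v)

    atLeastNLines : HasAtLeastNLines G
    atLeastNLines = (λ x → p (role x)) , (λ x → q (role x)) , (λ x → p≢q (role x)) ,
                    λ x y x≢y → distinct x≢y (role x) (role y)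

isolated⇒deBruijnErdos : ∀ {n} → n ≥ 2 → (G : Graph n) {v : Fin n} → Isolated G v → DeBruijnErdos G
isolated⇒deBruijnErdos {1} (s≤s ()) G _
isolated⇒deBruijnErdos {2} _ G _ =
  inj₁ (zero , suc zero , (λ ()) , λ { zero → ˡ∈line G ; (suc zero) → ʳ∈line G })
isolated⇒deBruijnErdos {suc (suc (suc _))} _ G {v} iso =
  inj₂ (IsolatedVertex.atLeastNLines G iso (punchInᵢ≢i v zero) (punchInᵢ≢i v (suc zero))
                                          ((λ ()) ∘ punchIn-injective v zero (suc zero)))

lemma1 : (n : ℕ) → n ≥ 2 → (G : Graph n) → Disconnected G → DeBruijnErdos G
lemma1 n n≥2 G disc with disconnected⇒unreachable G disc
... | v , u , v↛u with mate⊎isolated G v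
...   | inj₁ (m , m≢v , v⇝m) = inj₂ (NontrivialComponent.atLeastNLines G v⇝m m≢v v↛u)
...   | inj₂ iso             = isolated⇒deBruijnErdos n≥2 G iso
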